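{- Let $s\geqslant 2$ and $n\geqslant 1$ be integers. Let $M_n$ be the multiset $\{\underbrace{1,\ldots,1}_{s-1},\underbrace{2,\ldots,2}_{s-1},\ldots,\underbrace{n-1,\ldots,n-1}_{s-1},n\}$, in which each of $1,\ldots,n-1$ occurs with multiplicity $s-1$ and $n$ occurs once. Let $\mathcal{A}^{(s-1)}_n$ be the collection of sub-multisets $A$ of $M_n$ such that $n\in A$ and $\min A\geqslant |A|$. Then $|\mathcal{A}^{(s-1)}_n| = F^{(s)}_n$.
   Context: Sub-multisets are counted as multisets (copies of the same integer are indistinguishable), and $|A|$ denotes the size of $A$ counted with multiplicity. The $s$-step Fibonacci sequence is defined by $F^{(s)}_{2-s}=\cdots=F^{(s)}_0=0$, $F^{(s)}_1=1$, and $F^{(s)}_n=F^{(s)}_{n-1}+\cdots+F^{(s)}_{n-s}$ for $n\geqslant 2$. -}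

module Defs where

open import Data.Nat using (ℕ; zero; suc; _+_; _∸_; _≤_; _<_; _≟_)
open import Data.Fin using (Fin; toℕ)
open import Data.Vec using (Vec; lookup; tabulate)
open import Data.List using (List; []; _∷_; take)
open import Data.Nat.ListAction using (sum)
open import Data.Product using (Σ; _×_)
open import Relation.Nullary using (yes; no)
open import Relation.Binary.PropositionalEquality using (_≡_)

-- s-step Fibonacci numbers.
-- fibsRev s n = [F_n, F_{n-1}, ..., F_1, F_0]; terms with negative index are 0,
-- so truncating (take s) of the list is the same as summing F_{n-1},...,F_{n-s}.
fibsRev : ℕ → ℕ → List ℕ
fibsRev s zero = 0 ∷ []
fibsRev s (suc zero) = 1 ∷ 0 ∷ []
fibsRev s (suc (suc m)) = extend s (fibsRev s (suc m))
  where
  extend : ℕ → List ℕ → List ℕ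
  extend s L = sum (take s L) ∷ L

headOr0 : List ℕ → ℕ
headOr0 [] = 0
headOr0 (x ∷ _) = x

F : ℕ → ℕ → ℕ
F s n = headOr0 (fibsRev s n)

-- A multiset with elements from {1,…,n} is represented by its multiplicity
-- vector A : Vec ℕ n, where  lookup A i  is the multiplicity of the integer toℕ i + 1.
MSet : ℕ → Set
MSet n = Vec ℕ n

M : ℕ → (n : ℕ) → MSet n
M s n = tabulate λ i → mult (toℕ i + 1 ≟ n)
  where
  mult : ∀ {P : Set} → Relation.Nullary.Dec P → ℕ
  mult (yes _) = 1
  mult (no _) = s ∸ 1

_⊆ₘ_ : ∀ {n} → MSet n → MSet n → Set
A ⊆ₘ B = ∀ i → lookup A i ≤ lookup B i

_∈ₘ_ : ∀ {n} → ℕ → MSet n → Set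
_∈ₘ_ {n} x A = Σ (Fin n) λ i → (toℕ i + 1 ≡ x) × (0 < lookup A i)

∣_∣ₘ : ∀ {n} → MSet n → ℕ
∣ A ∣ₘ = Data.Vec.sum A

minAtLeast : ∀ {n} → MSet n → ℕ → Set
minAtLeast A k = ∀ x → x ∈ₘ A → k ≤ x

InFamily : (s n : ℕ) → MSet n → Set
InFamily s n A = (A ⊆ₘ M s n) × (n ∈ₘ A) × minAtLeast A ∣ A ∣ₘ

-- Write A through its multiplicities a₁, …, aₙ. The conditions say aₙ = 1, aᵢ ≤ s − 1 for i < n, and
-- aᵢ = 0 for i < |A| = a₁ + ⋯ + aₙ. Such multiplicity lists are exactly  0^(ΣB) ++ B ++ [1]  for a word B
-- over {0, …, s − 1} with |B| + ΣB = n − 1, i.e. for a composition (b + 1)_{b ∈ B} of n − 1 into parts of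
-- size at most s; splitting off the first part shows that these are counted by the s-step Fibonacci
-- recurrence.
module Submission where

open import Defs
open import Algebra.Properties.CommutativeSemigroup using (x∙yz≈y∙xz)
open import Data.Empty using (⊥)
open import Data.Fin using (Fin; toℕ) renaming (zero to fzero; suc to fsuc)
open import Data.List using (List; []; _∷_; _++_; _∷ʳ_; length; map; replicate; take; downFrom)
open import Data.List.Membership.Propositional using (_∈_)
open import Data.List.Membership.Propositional.Properties
  using (∈-map⁺; ∈-map⁻; ∈-++⁺ˡ; ∈-++⁺ʳ; ∈-++⁻)
open import Data.List.Properties
  using (length-++; length-map; length-replicate; ∷-injective; ∷-injectiveˡ; ∷-injectiveʳ; ∷ʳ-injectiveˡ; ++-assoc; ++-cancelˡ)
open import Data.List.Relation.Binary.Pointwise using (Pointwise; []; _∷_)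
open import Data.List.Relation.Unary.All using (All; []; _∷_)
import Data.List.Relation.Unary.All as All
import Data.List.Relation.Unary.All.Properties as All
open import Data.List.Relation.Unary.AllPairs using ([]; _∷_)
open import Data.List.Relation.Unary.Any using (here)
open import Data.List.Relation.Unary.Unique.Propositional using (Unique)
import Data.List.Relation.Unary.Unique.Propositional.Properties as Unique
open import Data.Nat using (ℕ; zero; suc; _+_; _∸_; _≤_; _<_; z≤n; s≤s; _≟_)
open import Data.Nat.ListAction using (sum)
open import Data.Nat.ListAction.Properties using (sum-++)
open import Data.Nat.Properties
open import Data.Vec using (Vec; []; _∷_; lookup; tabulate; toList)
open import Data.Vec.Properties using (lookup∘tabulate; length-toList)
open import Data.Product using (Σ; Σ-syntax; _×_; _,_; proj₁; proj₂)
open import Data.Sum using (inj₁; inj₂)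
open import Function.Base using (_∘_; case_of_)
open import Function.Bundles using (_⇔_; mk⇔; Equivalence)
open import Function.Construct.Composition using (_⇔-∘_)
open import Function.Construct.Symmetry using (⇔-sym)
open Equivalence using (to; from)
open import Relation.Nullary using (yes; no; contradiction)
open import Relation.Binary.PropositionalEquality
  using (_≡_; refl; sym; trans; cong; cong₂; subst; subst₂; module ≡-Reasoning)

Enumerates : {A : Set} → (A → Set) → List A → Set
Enumerates P xs = Unique xs × (∀ x → x ∈ xs ⇔ P x)

unique-map-injectiveOn : {A B : Set} {P : A → Set} {f : A → B} {xs : List A} →
  (∀ {x y} → P x → P y → f x ≡ f y → x ≡ y) → All P xs → Unique xs → Unique (map f xs)
unique-map-injectiveOn inj []         []         = []
unique-map-injectiveOn inj (px ∷ pxs) (x∉xs ∷ u) =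
  All.map⁺ (All.zipWith (λ (py , x≢y) fx≡fy → x≢y (inj px py fx≡fy)) (pxs , x∉xs)) ∷
  unique-map-injectiveOn inj pxs u

toVec : (n : ℕ) → List ℕ → Vec ℕ n
toVec zero    _        = []
toVec (suc n) []       = 0 ∷ toVec n []
toVec (suc n) (x ∷ xs) = x ∷ toVec n xs

toList-toVec : ∀ {n xs} → length xs ≡ n → toList (toVec n xs) ≡ xs
toList-toVec {zero}  {[]}     _  = refl
toList-toVec {suc n} {x ∷ xs} eq = cong (x ∷_) (toList-toVec (suc-injective eq))

toVec-toList : ∀ {n} (A : Vec ℕ n) → toVec n (toList A) ≡ A
toVec-toList []      = refl
toVec-toList (x ∷ A) = cong (x ∷_) (toVec-toList A)

replicate-+ : {A : Set} → ∀ m n (x : A) → replicate (m + n) x ≡ replicate m x ++ replicate n x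
replicate-+ zero    n x = refl
replicate-+ (suc m) n x = cong (x ∷_) (replicate-+ m n x)

sum-replicate-0-++ : ∀ z xs → sum (replicate z 0 ++ xs) ≡ sum xs
sum-replicate-0-++ zero    xs = refl
sum-replicate-0-++ (suc z) xs = sum-replicate-0-++ z xs

sum-toList : ∀ {n} (A : Vec ℕ n) → ∣ A ∣ₘ ≡ sum (toList A)
sum-toList []      = refl
sum-toList (x ∷ A) = cong (x +_) (sum-toList A)

sum-take-∷ʳ-0 : ∀ k xs → sum (take k (xs ∷ʳ 0)) ≡ sum (take k xs)
sum-take-∷ʳ-0 zero          xs       = refl
sum-take-∷ʳ-0 (suc zero)    []       = refl
sum-take-∷ʳ-0 (suc (suc k)) []       = refl
sum-take-∷ʳ-0 (suc k)       (x ∷ xs) = cong (x +_) (sum-take-∷ʳ-0 k xs)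

-- A word B of weight m stands for the composition  map suc B  of m into parts of size at most c + 1.
module Words (c : ℕ) where

  Word : ℕ → List ℕ → Set
  Word m B = All (_≤ c) B × length B + sum B ≡ m

  fan : ℕ → ℕ → List (List (List ℕ)) → List (List ℕ)
  fan j zero    Xs       = []
  fan j (suc k) []       = []
  fan j (suc k) (X ∷ Xs) = map (j ∷_) X ++ fan (suc j) k Xs

  words : ℕ → List (List ℕ)
  wordsDownFrom : ℕ → List (List (List ℕ))

  words zero    = [] ∷ []
  words (suc m) = fan 0 (suc c) (wordsDownFrom m)

  wordsDownFrom zero    = words zero ∷ []
  wordsDownFrom (suc m) = words (suc m) ∷ wordsDownFrom m

  length-fan : ∀ j k Xs → length (fan j k Xs) ≡ sum (take k (map length Xs))
  length-fan j zero    Xs       = refl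
  length-fan j (suc k) []       = refl
  length-fan j (suc k) (X ∷ Xs) =
    trans (length-++ (map (j ∷_) X)) (cong₂ _+_ (length-map (j ∷_) X) (length-fan (suc j) k Xs))

  fibsRev≡lengths : ∀ m → fibsRev (suc c) (suc m) ≡ map length (wordsDownFrom m) ∷ʳ 0
  fibsRev≡lengths zero    = refl
  fibsRev≡lengths (suc m) = cong₂ _∷_ (begin
      sum (take (suc c) (fibsRev (suc c) (suc m)))
        ≡⟨ cong (sum ∘ take (suc c)) (fibsRev≡lengths m) ⟩
      sum (take (suc c) (map length (wordsDownFrom m) ∷ʳ 0))
        ≡⟨ sum-take-∷ʳ-0 (suc c) (map length (wordsDownFrom m)) ⟩
      sum (take (suc c) (map length (wordsDownFrom m)))
        ≡⟨ length-fan 0 (suc c) (wordsDownFrom m) ⟨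
      length (words (suc m))
        ∎)
    (fibsRev≡lengths m)
    where open ≡-Reasoning

  length-words : ∀ m → length (words m) ≡ F (suc c) (suc m)
  length-words zero    = refl
  length-words (suc m) = sym (cong headOr0 (fibsRev≡lengths (suc m)))

  Memo : ℕ → List (List (List ℕ)) → Set
  Memo n = Pointwise (λ m → Enumerates (Word m)) (downFrom n)

  -- the members of fan j k Xs when Xs = [X_{n-1}, …, X₀] with Xₘ enumerating the words of weight m
  Fanned : ℕ → ℕ → ℕ → List ℕ → Set
  Fanned j k n B =
    Σ[ t ∈ ℕ ] Σ[ m ∈ ℕ ] Σ[ B′ ∈ List ℕ ] B ≡ t + j ∷ B′ × t < k × suc (t + m) ≡ n × Word m B′

  fan-sound : ∀ {n Xs} → Memo n Xs → ∀ j k {B} → B ∈ fan j k Xs → Fanned j k n B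
  fan-sound                  memo        j zero    ()
  fan-sound {zero}           []          j (suc k) ()
  fan-sound {suc n} {X ∷ Xs} (eX ∷ memo) j (suc k) B∈ with ∈-++⁻ (map (j ∷_) X) B∈
  ... | inj₁ B∈jX = let B′ , B′∈X , eq = ∈-map⁻ (j ∷_) B∈jX in
    0 , n , B′ , eq , s≤s z≤n , refl , to (proj₂ eX B′) B′∈X
  ... | inj₂ B∈fan = let t , m , B′ , eq , t<k , weight , w = fan-sound memo (suc j) k B∈fan in
    suc t , m , B′ , trans eq (cong (_∷ B′) (+-suc t j)) , s≤s t<k , cong suc weight , w

  fan-complete : ∀ {n Xs} → Memo n Xs → ∀ j k {B} → Fanned j k n B → B ∈ fan j k Xs
  fan-complete {suc n} (eX ∷ memo) j (suc k) (zero , m , B′ , refl , _ , refl , w) =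
    ∈-++⁺ˡ (∈-map⁺ (j ∷_) (from (proj₂ eX B′) w))
  fan-complete {suc n} {X ∷ Xs} (eX ∷ memo) j (suc k) (suc t , m , B′ , refl , s≤s t<k , eq , w) =
    subst (_∈ fan j (suc k) (X ∷ Xs)) (cong (_∷ B′) (+-suc t j))
      (∈-++⁺ʳ (map (j ∷_) X)
        (fan-complete memo (suc j) k (t , m , B′ , refl , t<k , suc-injective eq , w)))

  fan-unique : ∀ {n Xs} → Memo n Xs → ∀ j k → Unique (fan j k Xs)
  fan-unique                  memo        j zero    = []
  fan-unique {zero}           []          j (suc k) = []
  fan-unique {suc n} {X ∷ Xs} (eX ∷ memo) j (suc k) =
    Unique.++⁺ (Unique.map⁺ ∷-injectiveʳ (proj₁ eX)) (fan-unique memo (suc j) k)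
      λ (l , r) → heads-differ l r
    where
    heads-differ : ∀ {B} → B ∈ map (j ∷_) X → B ∈ fan (suc j) k Xs → ⊥
    heads-differ B∈jX B∈fan with ∈-map⁻ (j ∷_) B∈jX | fan-sound memo (suc j) k B∈fan
    ... | _ , _ , refl | t , _ , _ , eq , _ = m≢1+n+m j (trans (∷-injectiveˡ eq) (+-suc t j))

  word-suc⇔fanned : ∀ {m B} → Word (suc m) B ⇔ Fanned 0 (suc c) (suc m) B
  word-suc⇔fanned {m} = mk⇔ split join
    where
    split : ∀ {B} → Word (suc m) B → Fanned 0 (suc c) (suc m) B
    split {t ∷ B′} (t≤c ∷ ws , eq) =
      t , length B′ + sum B′ , B′ , cong (_∷ B′) (sym (+-identityʳ t)) , s≤s t≤c ,
      trans (cong suc (x∙yz≈y∙xz +-commutativeSemigroup t (length B′) (sum B′))) eq , ws , refl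
    join : ∀ {B} → Fanned 0 (suc c) (suc m) B → Word (suc m) B
    join (t , m′ , B′ , refl , s≤s t≤c , eq , ws , w) rewrite +-identityʳ t =
      t≤c ∷ ws ,
      trans (cong suc (x∙yz≈y∙xz +-commutativeSemigroup (length B′) t (sum B′)))
        (trans (cong (suc ∘ (t +_)) w) eq)

  enumerates-words-suc : ∀ {m} → Memo (suc m) (wordsDownFrom m) →
    Enumerates (Word (suc m)) (words (suc m))
  enumerates-words-suc memo =
    fan-unique memo 0 (suc c) ,
    λ B → ⇔-sym word-suc⇔fanned ⇔-∘ mk⇔ (fan-sound memo 0 (suc c)) (fan-complete memo 0 (suc c))

  enumerates-words-zero : Enumerates (Word 0) (words 0)
  enumerates-words-zero = [] ∷ [] , λ B → mk⇔ (λ { (here refl) → [] , refl }) empty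
    where
    empty : ∀ {B} → Word 0 B → B ∈ words 0
    empty {[]}    _       = here refl
    empty {_ ∷ _} (_ , ())

  memo-words : ∀ m → Memo (suc m) (wordsDownFrom m)
  memo-words zero    = enumerates-words-zero ∷ []
  memo-words (suc m) = enumerates-words-suc (memo-words m) ∷ memo-words m

  enumerates-words : ∀ m → Enumerates (Word m) (words m)
  enumerates-words zero    = enumerates-words-zero
  enumerates-words (suc m) = enumerates-words-suc (memo-words m)

module Placement (c : ℕ) where

  -- Placed S d xs: in the multiset whose multiplicities of d + 1, d + 2, … are  xs ∷ʳ 1,
  -- the multiplicities in xs are at most c and every element is at least S.
  Placed : ℕ → ℕ → List ℕ → Set
  Placed S d []       = S ≤ d + 1
  Placed S d (x ∷ xs) = x ≤ c × (0 < x → S ≤ d + 1) × Placed S (suc d) xs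

  encode : List ℕ → List ℕ
  encode B = replicate (sum B) 0 ++ B

  placed-replicate-0-++ : ∀ {S d} z {xs} → Placed S (d + z) xs → Placed S d (replicate z 0 ++ xs)
  placed-replicate-0-++ {S} {d} zero    {xs} p = subst (λ e → Placed S e xs) (+-identityʳ d) p
  placed-replicate-0-++ {S} {d} (suc z) {xs} p =
    z≤n , (λ ()) , placed-replicate-0-++ z (subst (λ e → Placed S e xs) (+-suc d z) p)

  placed-late : ∀ {S d B} → All (_≤ c) B → S ≤ d + 1 → Placed S d B
  placed-late []         S≤ = S≤
  placed-late (x≤c ∷ ws) S≤ = x≤c , (λ _ → S≤) , placed-late ws (m≤n⇒m≤1+n S≤)

  placed-encode : ∀ {B} → All (_≤ c) B → Placed (suc (sum B)) 0 (encode B)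
  placed-encode {B} ws = placed-replicate-0-++ (sum B) (placed-late ws (≤-reflexive (+-comm 1 (sum B))))

  placed-split : ∀ {S d xs} → Placed S d xs →
    Σ[ z ∈ ℕ ] Σ[ B ∈ List ℕ ] xs ≡ replicate z 0 ++ B × All (_≤ c) B × S ≤ d + (z + 1)
  placed-split {xs = []} S≤ = 0 , [] , refl , [] , S≤
  placed-split {S} {d} {zero ∷ xs} (_ , _ , p) =
    let z , B , eq , ws , S≤ = placed-split p in
    suc z , B , cong (0 ∷_) eq , ws , subst (S ≤_) (sym (+-suc d (z + 1))) S≤
  placed-split {xs = suc x ∷ xs} (x≤c , S≤ , p) =
    let z , B , eq , ws , _ = placed-split p in
    0 , suc x ∷ replicate z 0 ++ B , cong (suc x ∷_) eq ,
    x≤c ∷ All.++⁺ (All.replicate⁺ z z≤n) ws , S≤ (s≤s z≤n)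

  -- surplus leading zeros are moved into the word
  replicate-0-++≡encode : ∀ z B → sum B ≤ z → replicate z 0 ++ B ≡ encode (replicate (z ∸ sum B) 0 ++ B)
  replicate-0-++≡encode z B sumB≤z = begin
    replicate z 0 ++ B
      ≡⟨ cong (λ n → replicate n 0 ++ B) (m+[n∸m]≡n sumB≤z) ⟨
    replicate (sum B + w) 0 ++ B
      ≡⟨ cong (_++ B) (replicate-+ (sum B) w 0) ⟩
    (replicate (sum B) 0 ++ replicate w 0) ++ B
      ≡⟨ ++-assoc (replicate (sum B) 0) (replicate w 0) B ⟩
    replicate (sum B) 0 ++ (replicate w 0 ++ B)
      ≡⟨ cong (λ n → replicate n 0 ++ (replicate w 0 ++ B)) (sum-replicate-0-++ w B) ⟨
    encode (replicate w 0 ++ B)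
      ∎
    where
    open ≡-Reasoning
    w : ℕ
    w = z ∸ sum B

  Encoded : List ℕ → Set
  Encoded xs = Σ[ B ∈ List ℕ ] All (_≤ c) B × xs ≡ encode B

  placed⇔encoded : ∀ {xs} → Placed (suc (sum xs)) 0 xs ⇔ Encoded xs
  placed⇔encoded = mk⇔ decode λ { (B , ws , refl) →
    subst (λ S → Placed (suc S) 0 (encode B)) (sym (sum-replicate-0-++ (sum B) B)) (placed-encode ws) }
    where
    decode : ∀ {xs} → Placed (suc (sum xs)) 0 xs → Encoded xs
    decode p with placed-split p
    ... | z , B , refl , ws , S≤ =
      replicate (z ∸ sum B) 0 ++ B , All.++⁺ (All.replicate⁺ _ z≤n) ws , replicate-0-++≡encode z B sumB≤z
      where
      sumB≤z : sum B ≤ z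
      sumB≤z = ≤-pred (subst₂ _≤_ (cong suc (sum-replicate-0-++ z B)) (+-comm z 1) S≤)

  length-encode-∷ʳ : ∀ B → length (encode B ∷ʳ 1) ≡ suc (length B + sum B)
  length-encode-∷ʳ B = begin
    length (encode B ∷ʳ 1)                         ≡⟨ length-++ (encode B) ⟩
    length (encode B) + 1                          ≡⟨ +-comm (length (encode B)) 1 ⟩
    suc (length (replicate (sum B) 0 ++ B))        ≡⟨ cong suc (length-++ (replicate (sum B) 0)) ⟩
    suc (length (replicate (sum B) 0) + length B)  ≡⟨ cong (suc ∘ (_+ length B)) (length-replicate (sum B)) ⟩
    suc (sum B + length B)                         ≡⟨ cong suc (+-comm (sum B) (length B)) ⟩
    suc (length B + sum B)                         ∎
    where open ≡-Reasoning

  encode-injective : ∀ {B B′} → encode B ≡ encode B′ → B ≡ B′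
  encode-injective {B} {B′} eq =
    ++-cancelˡ (replicate (sum B) 0) B B′ (trans eq (cong (λ n → replicate n 0 ++ B′) (sym same-sum)))
    where
    same-sum : sum B ≡ sum B′
    same-sum = trans (sym (sum-replicate-0-++ (sum B) B))
                     (trans (cong sum eq) (sum-replicate-0-++ (sum B′) B′))

-- M s n as an explicit tabulation, so that lookup∘tabulate exposes the case split in its entries
M-tabulation : ∀ s n → Σ[ f ∈ (Fin n → ℕ) ] M s n ≡ tabulate f
M-tabulation s n = _ , refl

lookup-M-suc : ∀ s k (i : Fin (suc k)) → lookup (M s (suc (suc k))) (fsuc i) ≡ lookup (M s (suc k)) i
lookup-M-suc s k i
  rewrite lookup∘tabulate (proj₁ (M-tabulation s (suc (suc k)))) (fsuc i)
        | lookup∘tabulate (proj₁ (M-tabulation s (suc k))) i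
  with suc (toℕ i + 1) ≟ suc (suc k) | toℕ i + 1 ≟ suc k
... | yes _ | yes _ = refl
... | no _  | no _  = refl
... | yes p | no ¬p = contradiction (suc-injective p) ¬p
... | no ¬p | yes p = contradiction (cong suc p) ¬p

module Family (c : ℕ) where
  open Words c
  open Placement c

  -- InFamily (suc c) n A for A listing the multiplicities of d + 1, …, d + n, and with ∣ A ∣ₘ
  -- replaced by S; Fam ∣ A ∣ₘ 0 A is InFamily (suc c) n A on the nose.
  Fam : ℕ → ℕ → ∀ {n} → MSet n → Set
  Fam S d {n} A = A ⊆ₘ M (suc c) n × n ∈ₘ A × (∀ x → x ∈ₘ A → S ≤ d + x)

  fam-[] : ∀ {S d x} → Fam S d (x ∷ []) ⇔ (x ≡ 1 × S ≤ d + 1)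
  fam-[] {S} {d} = mk⇔
    (λ { (sub , (fzero , _ , pos) , S≤) → ≤-antisym (sub fzero) pos , S≤ 1 (fzero , refl , pos) })
    (λ { (refl , S≤) →
      (λ { fzero → ≤-refl }) , (fzero , refl , s≤s z≤n) , λ { _ (fzero , refl , _) → S≤ } })

  fam-∷ : ∀ {S d x y k} {A : MSet k} →
    Fam S d (x ∷ y ∷ A) ⇔ (x ≤ c × (0 < x → S ≤ d + 1) × Fam S (suc d) (y ∷ A))
  fam-∷ {S} {d} {x} {y} {k} {A} = mk⇔ split join
    where
    split : Fam S d (x ∷ y ∷ A) → x ≤ c × (0 < x → S ≤ d + 1) × Fam S (suc d) (y ∷ A)
    split (sub , (fsuc i , eq , pos) , S≤) =
      sub fzero , (λ pos₀ → S≤ 1 (fzero , refl , pos₀)) ,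
      (λ j → subst (lookup (y ∷ A) j ≤_) (lookup-M-suc (suc c) k j) (sub (fsuc j))) ,
      (i , suc-injective eq , pos) ,
      λ { _ (j , refl , posⱼ) → subst (S ≤_) (+-suc d (toℕ j + 1)) (S≤ _ (fsuc j , refl , posⱼ)) }
    join : x ≤ c × (0 < x → S ≤ d + 1) × Fam S (suc d) (y ∷ A) → Fam S d (x ∷ y ∷ A)
    join (x≤c , S≤₀ , sub , (i , eq , pos) , S≤) =
      (λ { fzero    → x≤c
         ; (fsuc j) → subst (lookup (y ∷ A) j ≤_) (sym (lookup-M-suc (suc c) k j)) (sub j) }) ,
      (fsuc i , cong suc eq , pos) ,
      λ { _ (fzero , refl , pos₀) → S≤₀ pos₀
        ; _ (fsuc j , refl , posⱼ) → subst (S ≤_) (sym (+-suc d (toℕ j + 1))) (S≤ _ (j , refl , posⱼ)) }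

  fam⇔placed : ∀ {k} S d (A : MSet (suc k)) →
    Fam S d A ⇔ (Σ[ xs ∈ List ℕ ] toList A ≡ xs ∷ʳ 1 × Placed S d xs)
  fam⇔placed S d (x ∷ []) = mk⇔
    (λ fam → let x≡1 , S≤ = to fam-[] fam in [] , cong (_∷ []) x≡1 , S≤)
    (λ { ([] , refl , S≤) → from fam-[] (refl , S≤)
       ; (_ ∷ [] , () , _)
       ; (_ ∷ _ ∷ _ , () , _) })
  fam⇔placed S d (x ∷ y ∷ A) = mk⇔
    (λ fam → let x≤c , S≤₀ , fam′ = to fam-∷ fam
                 xs , eq , p = to (fam⇔placed S (suc d) (y ∷ A)) fam′
             in x ∷ xs , cong (x ∷_) eq , x≤c , S≤₀ , p)
    (λ { ([] , () , _)
       ; (x′ ∷ xs , eq , x′≤c , S≤₀ , p) → case ∷-injective eq of λ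
           { (refl , eq′) →
             from fam-∷ (x′≤c , S≤₀ , from (fam⇔placed S (suc d) (y ∷ A)) (xs , eq′ , p)) } })

  inFamily⇔word : ∀ {m} (A : MSet (suc m)) →
    InFamily (suc c) (suc m) A ⇔ (Σ[ B ∈ List ℕ ] Word m B × toList A ≡ encode B ∷ʳ 1)
  inFamily⇔word {m} A = mk⇔ decode encoded
    where
    size : ∀ {xs} → toList A ≡ xs ∷ʳ 1 → ∣ A ∣ₘ ≡ suc (sum xs)
    size {xs} eq =
      trans (sum-toList A) (trans (cong sum eq) (trans (sum-++ xs (1 ∷ [])) (+-comm (sum xs) 1)))
    decode : InFamily (suc c) (suc m) A → Σ[ B ∈ List ℕ ] Word m B × toList A ≡ encode B ∷ʳ 1
    decode fam with to (fam⇔placed ∣ A ∣ₘ 0 A) fam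
    ... | xs , eq , p with to placed⇔encoded (subst (λ S → Placed S 0 xs) (size eq) p)
    ... | B , ws , refl =
      B , (ws , suc-injective (trans (sym (length-encode-∷ʳ B)) (trans (cong length (sym eq)) (length-toList A)))) ,
      eq
    encoded : (Σ[ B ∈ List ℕ ] Word m B × toList A ≡ encode B ∷ʳ 1) → InFamily (suc c) (suc m) A
    encoded (B , (ws , _) , eq) =
      from (fam⇔placed ∣ A ∣ₘ 0 A)
        (encode B , eq ,
         subst (λ S → Placed S 0 (encode B)) (sym (size eq)) (from placed⇔encoded (B , ws , refl)))

  multiplicities : (m : ℕ) → List ℕ → MSet (suc m)
  multiplicities m B = toVec (suc m) (encode B ∷ʳ 1)

  toList-multiplicities : ∀ {m B} → Word m B → toList (multiplicities m B) ≡ encode B ∷ʳ 1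
  toList-multiplicities {B = B} (_ , w) = toList-toVec (trans (length-encode-∷ʳ B) (cong suc w))

  family : (m : ℕ) → List (MSet (suc m))
  family m = map (multiplicities m) (words m)

  enumerates-family : ∀ m → Enumerates (InFamily (suc c) (suc m)) (family m)
  enumerates-family m = unique-map-injectiveOn injective all-words (proj₁ (enumerates-words m)) , members
    where
    words⇔ : ∀ B → B ∈ words m ⇔ Word m B
    words⇔ = proj₂ (enumerates-words m)
    all-words : All (Word m) (words m)
    all-words = All.tabulate (λ {B} → to (words⇔ B))
    injective : ∀ {B B′} → Word m B → Word m B′ → multiplicities m B ≡ multiplicities m B′ → B ≡ B′
    injective {B} {B′} w w′ eq = encode-injective (∷ʳ-injectiveˡ (encode B) (encode B′)
      (trans (sym (toList-multiplicities w)) (trans (cong toList eq) (toList-multiplicities w′))))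
    members : ∀ A → A ∈ family m ⇔ InFamily (suc c) (suc m) A
    members A = mk⇔
      (λ A∈ → let B , B∈ , A≡ = ∈-map⁻ (multiplicities m) A∈
                  w = to (words⇔ B) B∈
              in from (inFamily⇔word A) (B , w , trans (cong toList A≡) (toList-multiplicities w)))
      (λ fam → let B , w , eq = to (inFamily⇔word A) fam in
        subst (_∈ family m) (trans (cong (toVec (suc m)) (sym eq)) (toVec-toList A))
          (∈-map⁺ (multiplicities m) (from (words⇔ B) w)))

theorem1 : (s n : ℕ) → 2 ≤ s → 1 ≤ n →
    Σ (List (MSet n)) λ L →
    Unique L × (∀ A → (A ∈ L) ⇔ InFamily s n A) × (length L ≡ F s n)
theorem1 zero    _       () _
theorem1 (suc c) zero    _  ()
theorem1 (suc c) (suc m) _  _  =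
  family m , proj₁ (enumerates-family m) , proj₂ (enumerates-family m) ,
  trans (length-map (multiplicities m) (words m)) (length-words m)
  where
  open Words c
  open Family c
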